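{- Let $q$ be a prime with $q\equiv 1\pmod 3$ and let $z\in\mathbb{F}_q$ with $z\neq 0,1$. The curve $Y^2=X^6+2(1-2z)X^3+1$ over $\mathbb{F}_q$ is equivalent to the curve $$Y^2=(1-z)X^6+3(2+z)X^4+3(3-z)X^2+z.$$
   Context: Two curves of the form $Y^2=F(X)$ with $F\in\mathbb{F}_q[X]$ are called equivalent if one is taken into the other by a fractional linear transformation $X\mapsto \frac{aX+b}{cX+d}$ together with the associated transformation $Y\mapsto \frac{eY}{(cX+d)^3}$, where $a,b,c,d\in\mathbb{F}_q$, $ad-bc\neq 0$ and $e\in\mathbb{F}_q^{\times}$. -}

module Defs where

open import Data.Nat using (ℕ; zero; suc)
open import Data.Integer using (ℤ; +_; _+_; _*_; _-_; -_)
open import Data.Integer.Divisibility using (_∣_)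
open import Data.List using (List; []; _∷_)
open import Data.Vec using (Vec; []; _∷_)
open import Data.Product using (∃; _×_; ∃-syntax)
open import Relation.Nullary using (¬_)

-- Elements of F_q (q prime) are represented by integers; equality in F_q
-- is congruence modulo q.
_≡_[mod_] : ℤ → ℤ → ℕ → Set
a ≡ b [mod q ] = (+ q) ∣ (a - b)

-- Polynomials in X over ℤ: coefficient lists, lowest degree first.
Poly : Set
Poly = List ℤ

_+ₚ_ : Poly → Poly → Poly
[] +ₚ g = g
(x ∷ f) +ₚ [] = x ∷ f
(x ∷ f) +ₚ (y ∷ g) = (x + y) ∷ (f +ₚ g)

_·ₚ_ : ℤ → Poly → Poly
c ·ₚ [] = []
c ·ₚ (x ∷ f) = (c * x) ∷ (c ·ₚ f)

_*ₚ_ : Poly → Poly → Poly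
[] *ₚ g = []
(x ∷ f) *ₚ g = (x ·ₚ g) +ₚ (+ 0 ∷ (f *ₚ g))

_^ₚ_ : Poly → ℕ → Poly
f ^ₚ zero = + 1 ∷ []
f ^ₚ suc n = f *ₚ (f ^ₚ n)

coeff : Poly → ℕ → ℤ
coeff [] n = + 0
coeff (x ∷ f) zero = x
coeff (x ∷ f) (suc n) = coeff f n

_≡ₚ_[mod_] : Poly → Poly → ℕ → Set
f ≡ₚ g [mod q ] = ∀ n → coeff f n ≡ coeff g n [mod q ]

Sextic : Set
Sextic = Vec ℤ 7

toPoly : ∀ {n} → Vec ℤ n → Poly
toPoly [] = []
toPoly (x ∷ v) = x ∷ toPoly v

-- (cX+d)^6 F((aX+b)/(cX+d)) = Σ_{i=0}^{6} f_i (aX+b)^i (cX+d)^{6-i}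
homog : ∀ {n} → ℤ → ℤ → ℤ → ℤ → ℕ → ℕ → Vec ℤ n → Poly
homog a b c d i k [] = []
homog a b c d i k (f ∷ fs) =
  (f ·ₚ (((b ∷ a ∷ []) ^ₚ i) *ₚ ((d ∷ c ∷ []) ^ₚ k)))
    +ₚ homog a b c d (suc i) (Data.Nat._∸_ k 1) fs

transformPoly : ℤ → ℤ → ℤ → ℤ → Sextic → Poly
transformPoly a b c d F = homog a b c d 0 6 F

-- Substituting X ↦ (aX+b)/(cX+d), Y ↦ eY/(cX+d)^3 into Y² = F(X) gives
-- e²Y² = (cX+d)^6 F((aX+b)/(cX+d)); the curves Y² = F(X), Y² = G(X) are
-- equivalent over F_q if for some a,b,c,d,e ∈ F_q with ad-bc ≠ 0, e ≠ 0
-- this is the curve Y² = G(X), i.e. e² G(X) = (cX+d)^6 F((aX+b)/(cX+d)).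
Equivalent : ℕ → Sextic → Sextic → Set
Equivalent q F G =
  ∃[ a ] ∃[ b ] ∃[ c ] ∃[ d ] ∃[ e ]
    (¬ ((a * d - b * c) ≡ + 0 [mod q ])) ×
    (¬ (e ≡ + 0 [mod q ])) ×
    (((e * e) ·ₚ toPoly G) ≡ₚ transformPoly a b c d F [mod q ])

curve1 : ℤ → Sextic
curve1 z = + 1 ∷ + 0 ∷ + 0 ∷ (+ 2 * (+ 1 - + 2 * z)) ∷ + 0 ∷ + 0 ∷ + 1 ∷ []

curve2 : ℤ → Sextic
curve2 z = z ∷ + 0 ∷ (+ 3 * (+ 3 - z)) ∷ + 0 ∷ (+ 3 * (+ 2 + z)) ∷ + 0 ∷ (+ 1 - z) ∷ []

module Submission where

-- The equivalence is realised by the Möbius substitution X ↦ (X+1)/(X-1),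
-- i.e. (a,b,c,d) = (1,1,1,-1) with determinant ad - bc = -2, together with
-- the scaling e = 2.  For F(X) = X⁶ + 2(1-2z)X³ + 1 one has the identity
--     (X-1)⁶ F((X+1)/(X-1)) = 4 ((1-z)X⁶ + 3(2+z)X⁴ + 3(3-z)X² + z)
-- already over ℤ[z], with no use of the hypotheses on q or z beyond q ∤ 2.
-- (The conditions z ≠ 0, 1 only ensure that the curves are non-singular.)

open import Defs
open import Data.Nat using (ℕ; suc; NonZero; _<_; _%_; s≤s; z≤n)
open import Data.Nat.Divisibility using (_∣0; >⇒∤) renaming (_∣_ to _∣ℕ_)
open import Data.Nat.Primality using (Prime; ¬prime[1])
open import Data.Integer using (ℤ; +_; -_; _*_; ∣_∣)
open import Data.Integer.Properties using (i≡j⇒i-j≡0; +-identityʳ)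
open import Data.Integer.Tactic.RingSolver using (solve)
open import Data.List using ([]; _∷_)
open import Data.Product using (_,_)
open import Relation.Binary.PropositionalEquality using (_≡_; refl; cong₂; subst)
open import Relation.Nullary using (¬_; contradiction)

transform-identity : ∀ z →
  ((+ 2) * (+ 2)) ·ₚ toPoly (curve2 z) ≡ transformPoly (+ 1) (+ 1) (+ 1) (- (+ 1)) (curve1 z)
transform-identity z =
  cong₂ _∷_ (solve (z ∷ [])) (cong₂ _∷_ (solve (z ∷ [])) (cong₂ _∷_ (solve (z ∷ []))
  (cong₂ _∷_ (solve (z ∷ [])) (cong₂ _∷_ (solve (z ∷ [])) (cong₂ _∷_ (solve (z ∷ []))
  (cong₂ _∷_ (solve (z ∷ [])) refl))))))

≡⇒≡-mod : ∀ {a b : ℤ} (q : ℕ) → a ≡ b → a ≡ b [mod q ]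
≡⇒≡-mod q a≡b rewrite i≡j⇒i-j≡0 a≡b = q ∣0

≡⇒≡ₚ-mod : ∀ {f g : Poly} (q : ℕ) → f ≡ g → f ≡ₚ g [mod q ]
≡⇒≡ₚ-mod {f} q refl n = ≡⇒≡-mod {coeff f n} q refl

small-nonzero-mod : ∀ {q} (a : ℤ) .{{_ : NonZero ∣ a ∣}} → ∣ a ∣ < q → ¬ (a ≡ + 0 [mod q ])
small-nonzero-mod {q} a |a|<q q∣a-0 =
  >⇒∤ |a|<q (subst (λ b → q ∣ℕ ∣ b ∣) (+-identityʳ a) q∣a-0)

prime≡1mod3⇒2<q : ∀ {q} → Prime q → q % 3 ≡ 1 → 2 < q
prime≡1mod3⇒2<q {1} q-prime _ = contradiction q-prime ¬prime[1]
prime≡1mod3⇒2<q {suc (suc (suc _))} _ _ = s≤s (s≤s (s≤s z≤n))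

lemma7p4 : (q : ℕ) → Prime q → q % 3 ≡ 1 → (z : ℤ) → ¬ (z ≡ + 0 [mod q ]) → ¬ (z ≡ + 1 [mod q ]) → Equivalent q (curve1 z) (curve2 z)
lemma7p4 q q-prime q≡1 z _ _ =
  + 1 , + 1 , + 1 , - (+ 1) , + 2 ,
  small-nonzero-mod (- (+ 2)) 2<q ,
  small-nonzero-mod (+ 2) 2<q ,
  ≡⇒≡ₚ-mod q (transform-identity z)
  where
  2<q : 2 < q
  2<q = prime≡1mod3⇒2<q q-prime q≡1
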